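{- Let $G$ be a connected unweighted graph with shortest-path metric $d$, fix a vertex $r$, and let $T$ be Gromov's distance approximating tree of $G$ rooted at $r$ (so that $d_T(T(x),T(y))=d'(x,y)$ for all vertices $x,y$). Then: (1) for all vertices $x,y$, $(x.y)'_r=f(x,y)$; (2) $x$ and $y$ are mapped to the same vertex of $T$ if and only if there is an integer $m$ with $d(x,r)=d(y,r)=m$ and a path $x=w_1,\dots,w_s=y$ in $G$ such that $d(w_i,r)\ge m$ for all $i$ and $\max\{d(w_i,r),d(w_{i+1},r)\}>m$ for all $1\le i\le s-1$.
   Context: $(u.v)_r=\tfrac12\big(d(u,r)+d(v,r)-d(u,v)\big)$. $f(x,y)=\max_{x=w_1,\dots,w_k=y}\min_{1\le i\le k-1}(w_i.w_{i+1})_r$ over all finite vertex sequences from $x$ to $y$ (with the convention $f(x,x)=d(x,r)$). Define $d'(x,y)=d(x,r)+d(y,r)-2f(x,y)$ and $(x.y)'_r=\tfrac12\big(d'(x,r)+d'(y,r)-d'(x,y)\big)$. The pseudometric $d'$ is $0$-hyperbolic, and Gromov's distance approximating tree $T$ is the weighted tree with a map $x\mapsto T(x)$ realizing $d'$ exactly, i.e. $d_T(T(x),T(y))=d'(x,y)$; in particular $T(x)=T(y)$ iff $d'(x,y)=0$. -}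

module Defs where

open import Level using (Level; _⊔_) renaming (suc to lsuc)
open import Data.Nat using (ℕ; zero; suc; _≥_; _>_) renaming (_⊔_ to _⊔ℕ_; _≤_ to _≤ℕ_)
open import Data.Integer using (+_)
open import Data.Rational using (ℚ; _/_; ½; _+_; _-_; _*_; _⊓_; _≤_)
open import Data.Empty using (⊥)
open import Data.Product using (Σ; _×_; ∃)
open import Data.List using (List; []; _∷_)
open import Relation.Binary.PropositionalEquality using (_≡_)

ι : ℕ → ℚ
ι n = (+ n) / 1

record Graph {a ℓ : Level} (V : Set a) (E : V → V → Set ℓ) : Set (a ⊔ ℓ) where
  field
    sym   : ∀ {x y} → E x y → E y x
    irrefl : ∀ {x} → E x x → ⊥

data Walk {a ℓ : Level} {V : Set a} (E : V → V → Set ℓ) : V → V → Set (a ⊔ ℓ) where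
  []  : ∀ {x} → Walk E x x
  _∷_ : ∀ {x w y} → E x w → Walk E w y → Walk E x y

length : ∀ {a ℓ} {V : Set a} {E : V → V → Set ℓ} {x y : V} → Walk E x y → ℕ
length []      = 0
length (_ ∷ p) = suc (length p)

-- d is the shortest-path metric of the graph (this also forces connectedness)
IsShortestPathMetric : ∀ {a ℓ} {V : Set a} (E : V → V → Set ℓ) → (V → V → ℕ) → Set (a ⊔ ℓ)
IsShortestPathMetric {V = V} E d =
  ∀ (x y : V) → (Σ (Walk E x y) λ p → length p ≡ d x y)
              × (∀ (p : Walk E x y) → d x y ≤ℕ length p)

gromov : ∀ {a} {V : Set a} → (V → V → ℕ) → V → V → V → ℚ
gromov d r u v = ½ * (ι (d u r) + ι (d v r) - ι (d u v))

-- For the sequence x = w_1, w_2, ..., w_k = y (k ≥ 2) given by its interior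
-- list [w_2, ..., w_{k-1}], the value  min_{1≤i≤k-1} g(w_i, w_{i+1}).
chainMin : ∀ {a} {V : Set a} → (V → V → ℚ) → V → List V → V → ℚ
chainMin g x []       y = g x y
chainMin g x (w ∷ ws) y = g x w ⊓ chainMin g w ws y

-- F is the function f of the paper:
-- f(x,y) = max over finite vertex sequences from x to y of the minimal
-- consecutive Gromov product (the maximum is attained).
IsF : ∀ {a} {V : Set a} → (V → V → ℕ) → V → (V → V → ℚ) → Set a
IsF {V = V} d r F =
  ∀ (x y : V) → (Σ (List V) λ ws → chainMin (gromov d r) x ws y ≡ F x y)
              × (∀ (ws : List V) → chainMin (gromov d r) x ws y ≤ F x y)

d′ : ∀ {a} {V : Set a} → (V → V → ℕ) → V → (V → V → ℚ) → V → V → ℚ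
d′ d r F x y = ι (d x r) + ι (d y r) - ι 2 * F x y

gromov′ : ∀ {a} {V : Set a} → (V → V → ℕ) → V → (V → V → ℚ) → V → V → ℚ
gromov′ d r F x y = ½ * (d′ d r F x r + d′ d r F y r - d′ d r F x y)

data GoodWalk {a ℓ : Level} {V : Set a} {E : V → V → Set ℓ}
              (d : V → V → ℕ) (r : V) (m : ℕ) : {x y : V} → Walk E x y → Set (a ⊔ ℓ) where
  end  : ∀ {x} → d x r ≥ m → GoodWalk d r m ([] {x = x})
  step : ∀ {x w y} {e : E x w} {p : Walk E w y} →
         d x r ≥ m → (d x r ⊔ℕ d w r) > m → GoodWalk d r m p → GoodWalk d r m (e ∷ p)

module Submission where

-- Write a = d(u,r), b = d(v,r), c = d(u,v); the Gromov product is
-- (u.v)_r = ½(a + b - c), and since every quantity involved is a natural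
-- number, a bound  m ≤ (u.v)_r  is the same as the ℕ-inequality
-- 2m + c ≤ a + b.  All rational reasoning is reduced to such ℕ-inequalities.
--
-- Part (1) only needs f(x,r) = 0, which holds because every chain ending in r
-- has a last link (w.r)_r = 0.  Part (2) rests on two facts:
--   * f(x,y) ≤ min(d(x,r), d(y,r)), so d'(x,y) = 0, i.e. 2f(x,y) = d(x,r)+d(y,r),
--     forces d(x,r) = d(y,r) = m and f(x,y) = m;
--   * f(x,y) ≥ m iff x and y are joined by a walk that is good at level m:
--     a walk of length L from z to v with 2m + L ≤ d(z,r) + d(v,r) is good
--     (so geodesics between the links of a chain can be concatenated), and
--     conversely every edge of a good walk has Gromov product ≥ m.

open import Defs
open import Level using (Level)
open import Data.Nat using (ℕ)
open import Data.Rational using (ℚ; 0ℚ)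
open import Data.Product using (Σ; _×_)
open import Relation.Binary.PropositionalEquality using (_≡_)

import Data.Nat as ℕ
import Data.Nat.Properties as ℕₚ
open import Data.Nat.Tactic.RingSolver using (solve-∀)
import Data.Integer as ℤ
import Data.Integer.Properties as ℤₚ
import Data.Nat.Coprimality as Coprime
open import Data.Rational using (mkℚ; ½; _/_; _+_; _-_; _*_; _≤_; *≤*)
open import Data.Rational.Properties
  using ( ≤-refl; ≤-reflexive; ≤-trans; ≤-antisym; <-≤-trans; <-irrefl; ≮⇒≥; normalize-coprime; /-cong
        ; +-comm; +-mono-≤; +-monoˡ-≤; +-mono-<; +-monoˡ-<; +-mono-<-≤
        ; ⊓-glb; p⊓q≤p; p⊓q≤q; p≤q⊓r⇒p≤q; p≤q⊓r⇒p≤r)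
import Data.Rational.Solver as ℚ-Solver
open import Data.Product using (_,_; proj₁; proj₂)
open import Data.List using (List; []; _∷_)
open import Data.Sum using (inj₁; inj₂)
open import Relation.Binary.PropositionalEquality
  using (refl; sym; trans; cong; cong₂; subst; subst₂; module ≡-Reasoning)

ι-canonical : ∀ n → ι n ≡ mkℚ (ℤ.+ n) 0 (Coprime.sym (Coprime.1-coprimeTo n))
ι-canonical n = normalize-coprime (Coprime.sym (Coprime.1-coprimeTo n))

ι-+ : ∀ m n → ι (m ℕ.+ n) ≡ ι m + ι n
ι-+ m n = begin
  ι (m ℕ.+ n)                               ≡⟨ /-cong {q₁ = 1} numerators refl ⟩
  (ℤ.+ m ℤ.* ℤ.+ 1 ℤ.+ ℤ.+ n ℤ.* ℤ.+ 1) / 1  ≡⟨ sum-of-canonical (ι m) (ι n) (ι-canonical m) (ι-canonical n) ⟩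
  ι m + ι n                                 ∎
  where
  open ≡-Reasoning
  numerators : ℤ.+ (m ℕ.+ n) ≡ ℤ.+ m ℤ.* ℤ.+ 1 ℤ.+ ℤ.+ n ℤ.* ℤ.+ 1
  numerators = sym (cong₂ ℤ._+_ (ℤₚ.*-identityʳ (ℤ.+ m)) (ℤₚ.*-identityʳ (ℤ.+ n)))
  -- for canonical fractions with denominator 1, ℚ-addition computes to this form
  sum-of-canonical : ∀ p q → p ≡ mkℚ (ℤ.+ m) 0 (Coprime.sym (Coprime.1-coprimeTo m)) →
                     q ≡ mkℚ (ℤ.+ n) 0 (Coprime.sym (Coprime.1-coprimeTo n)) →
                     (ℤ.+ m ℤ.* ℤ.+ 1 ℤ.+ ℤ.+ n ℤ.* ℤ.+ 1) / 1 ≡ p + q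
  sum-of-canonical _ _ refl refl = refl

ι-mono : ∀ {m n} → m ℕ.≤ n → ι m ≤ ι n
ι-mono {m} {n} m≤n rewrite ι-canonical m | ι-canonical n =
  *≤* (subst₂ ℤ._≤_ (sym (ℤₚ.*-identityʳ (ℤ.+ m))) (sym (ℤₚ.*-identityʳ (ℤ.+ n))) (ℤ.+≤+ m≤n))

ι-cancel : ∀ {m n} → ι m ≤ ι n → m ℕ.≤ n
ι-cancel {m} {n} ιm≤ιn rewrite ι-canonical m | ι-canonical n with ιm≤ιn
... | *≤* le with subst₂ ℤ._≤_ (ℤₚ.*-identityʳ (ℤ.+ m)) (ℤₚ.*-identityʳ (ℤ.+ n)) le
...   | ℤ.+≤+ m≤n = m≤n

ι-injective : ∀ {m n} → ι m ≡ ι n → m ≡ n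
ι-injective ιm≡ιn = ℕₚ.≤-antisym (ι-cancel (≤-reflexive ιm≡ιn)) (ι-cancel (≤-reflexive (sym ιm≡ιn)))

double-shift-mono : ∀ {p q} t → p ≤ q → p + p + t ≤ q + q + t
double-shift-mono t p≤q = +-monoˡ-≤ t (+-mono-≤ p≤q p≤q)

double-shift-cancel : ∀ {p q} t → p + p + t ≤ q + q + t → p ≤ q
double-shift-cancel t le = ≮⇒≥ λ q<p → <-irrefl refl (<-≤-trans (+-monoˡ-< t (+-mono-< q<p q<p)) le)

pinch : ∀ {p a b} → p ≤ a → p ≤ b → a + b ≡ p + p → p ≡ a
pinch p≤a p≤b sum≡ = ≤-antisym p≤a (≮⇒≥ λ p<a →
  <-irrefl (sym sum≡) (+-mono-<-≤ p<a p≤b))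

module _ where
  open ℚ-Solver.+-*-Solver

  halves-recombine : ∀ a b c → ½ * (a + b - c) + ½ * (a + b - c) + c ≡ a + b
  halves-recombine = solve 3 (λ a b c →
    con ½ :* (a :+ b :- c) :+ con ½ :* (a :+ b :- c) :+ c := a :+ b) refl

  minus-double≡0⇒ : ∀ p f → p - ι 2 * f ≡ 0ℚ → p ≡ f + f
  minus-double≡0⇒ p f eq = begin
    p                          ≡⟨ regroup p f ⟩
    (p - ι 2 * f) + (f + f)    ≡⟨ cong (_+ (f + f)) eq ⟩
    0ℚ + (f + f)               ≡⟨ zero-left (f + f) ⟩
    f + f                      ∎
    where
    open ≡-Reasoning
    regroup : ∀ p f → p ≡ (p - ι 2 * f) + (f + f)
    regroup = solve 2 (λ p f → p := (p :- con (ι 2) :* f) :+ (f :+ f)) refl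
    zero-left : ∀ x → 0ℚ + x ≡ x
    zero-left = solve 1 (λ x → con 0ℚ :+ x := x) refl

  ⇒minus-double≡0 : ∀ p f → p ≡ f + f → p - ι 2 * f ≡ 0ℚ
  ⇒minus-double≡0 _ f refl = cancel f
    where
    cancel : ∀ f → (f + f) - ι 2 * f ≡ 0ℚ
    cancel = solve 1 (λ f → (f :+ f) :- con (ι 2) :* f := con 0ℚ) refl

  -- ½(a + b - (a + b - 2f)) = f: the shape of (x.y)'_r once d'(x,r) = d(x,r)
  recover-product : ∀ a b f → ½ * (a + b - (a + b - ι 2 * f)) ≡ f
  recover-product = solve 3 (λ a b f →
    con ½ :* (a :+ b :- (a :+ b :- con (ι 2) :* f)) := f) refl

  -- ½(a + D - a) = 0 when D = 0: the shape of (w.r)_r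
  half-cancel : ∀ a D → D ≡ 0 → ½ * (a + ι D - a) ≡ 0ℚ
  half-cancel a _ refl = cancel a
    where
    cancel : ∀ a → ½ * (a + ι 0 - a) ≡ 0ℚ
    cancel = solve 1 (λ a → con ½ :* (a :+ con (ι 0) :- a) := con 0ℚ) refl

  -- a + D - 2f = a when D = 0 and f = 0: the shape of d'(x,r)
  d′-at-root : ∀ a D f → D ≡ 0 → f ≡ 0ℚ → a + ι D - ι 2 * f ≡ a
  d′-at-root a _ _ refl refl = cancel a
    where
    cancel : ∀ a → a + ι 0 - ι 2 * 0ℚ ≡ a
    cancel = solve 1 (λ a → a :+ con (ι 0) :- con (ι 2) :* con 0ℚ := a) refl

gromovℕ : ℕ → ℕ → ℕ → ℚ
gromovℕ a b c = ½ * (ι a + ι b - ι c)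

gromov-doubled : ∀ a b c → gromovℕ a b c + gromovℕ a b c + ι c ≡ ι (a ℕ.+ b)
gromov-doubled a b c = trans (halves-recombine (ι a) (ι b) (ι c)) (sym (ι-+ a b))

level-doubled : ∀ m c → ι m + ι m + ι c ≡ ι (m ℕ.+ m ℕ.+ c)
level-doubled m c = sym (trans (ι-+ (m ℕ.+ m) c) (cong (_+ ι c) (ι-+ m m)))

≤gromov⇒ : ∀ a b c m → ι m ≤ gromovℕ a b c → m ℕ.+ m ℕ.+ c ℕ.≤ a ℕ.+ b
≤gromov⇒ a b c m h =
  ι-cancel (subst₂ _≤_ (level-doubled m c) (gromov-doubled a b c) (double-shift-mono (ι c) h))

⇒≤gromov : ∀ a b c m → m ℕ.+ m ℕ.+ c ℕ.≤ a ℕ.+ b → ι m ≤ gromovℕ a b c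
⇒≤gromov a b c m h =
  double-shift-cancel (ι c) (subst₂ _≤_ (sym (level-doubled m c)) (sym (gromov-doubled a b c)) (ι-mono h))

⇒gromov≤ : ∀ a b c m → a ℕ.+ b ℕ.≤ m ℕ.+ m ℕ.+ c → gromovℕ a b c ≤ ι m
⇒gromov≤ a b c m h =
  double-shift-cancel (ι c) (subst₂ _≤_ (sym (gromov-doubled a b c)) (sym (level-doubled m c)) (ι-mono h))

half-≤ : ∀ {m n} → m ℕ.+ m ℕ.≤ n ℕ.+ n → m ℕ.≤ n
half-≤ {m} {n} h = ℕₚ.≮⇒≥ λ n<m → ℕₚ.<⇒≱ (ℕₚ.+-mono-< n<m n<m) h

max-exceeds : ∀ {m} a b → ℕ.suc (m ℕ.+ m) ℕ.≤ a ℕ.+ b → m ℕ.< a ℕ.⊔ b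
max-exceeds {m} a b h = ℕₚ.≮⇒≥ λ M≤m →
  ℕₚ.<⇒≱ h (ℕₚ.+-mono-≤ (ℕₚ.≤-trans (ℕₚ.m≤m⊔n a b) (ℕₚ.≤-pred M≤m))
                         (ℕₚ.≤-trans (ℕₚ.m≤n⊔m a b) (ℕₚ.≤-pred M≤m)))

level-edge : ∀ {m a b c} → m ℕ.≤ a → m ℕ.≤ b → m ℕ.< a ℕ.⊔ b → c ℕ.≤ 1 →
             m ℕ.+ m ℕ.+ c ℕ.≤ a ℕ.+ b
level-edge {m} {a} {b} {c} m≤a m≤b m<max c≤1 =
  ℕₚ.≤-trans (ℕₚ.+-monoʳ-≤ (m ℕ.+ m) c≤1)
             (subst (ℕ._≤ a ℕ.+ b) (ℕₚ.+-comm 1 (m ℕ.+ m)) strict)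
  where
  strict : m ℕ.+ m ℕ.< a ℕ.+ b
  strict with ℕₚ.⊔-sel a b
  ... | inj₁ max≡a = ℕₚ.+-mono-<-≤ (subst (m ℕ.<_) max≡a m<max) m≤b
  ... | inj₂ max≡b = ℕₚ.+-mono-≤-< m≤a (subst (m ℕ.<_) max≡b m<max)

chainMin-first : ∀ {a} {V : Set a} (g : V → V → ℚ) x ws y → Σ V λ w → chainMin g x ws y ≤ g x w
chainMin-first g x []       y = y , ≤-refl
chainMin-first g x (w ∷ ws) y = w , p⊓q≤p (g x w) (chainMin g w ws y)

chainMin-last : ∀ {a} {V : Set a} (g : V → V → ℚ) x ws y → Σ V λ w → chainMin g x ws y ≤ g w y
chainMin-last g x []       y = x , ≤-refl
chainMin-last g x (w ∷ ws) y =
  proj₁ rest , ≤-trans (p⊓q≤q (g x w) (chainMin g w ws y)) (proj₂ rest)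
  where rest = chainMin-last g w ws y

module _ {a ℓ} {V : Set a} {E : V → V → Set ℓ} where

  _++ʷ_ : ∀ {x y z} → Walk E x y → Walk E y z → Walk E x z
  []      ++ʷ q = q
  (e ∷ p) ++ʷ q = e ∷ (p ++ʷ q)

  length-++ : ∀ {x y z} (p : Walk E x y) (q : Walk E y z) → length (p ++ʷ q) ≡ length p ℕ.+ length q
  length-++ []      q = refl
  length-++ (e ∷ p) q = cong ℕ.suc (length-++ p q)

  -- the vertices w₂, …, w_s of a walk x = w₁, …, w_s = y; as a chain from x to y
  -- it has the links of the walk plus a final link (y.y)_r = d(y,r)
  interior : ∀ {x y} → Walk E x y → List V
  interior []                  = []
  interior (_∷_ {w = w} _ p) = w ∷ interior p

  module _ (graph : Graph V E) where

    reverse : ∀ {x y} → Walk E x y → Walk E y x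
    reverse []      = []
    reverse (e ∷ p) = reverse p ++ʷ (Graph.sym graph e ∷ [])

    length-reverse : ∀ {x y} (p : Walk E x y) → length (reverse p) ≡ length p
    length-reverse []      = refl
    length-reverse (e ∷ p) =
      trans (length-++ (reverse p) _) (trans (ℕₚ.+-comm _ 1) (cong ℕ.suc (length-reverse p)))

module ShortestPaths {a ℓ} {V : Set a} {E : V → V → Set ℓ} (graph : Graph V E)
                     {d : V → V → ℕ} (spm : IsShortestPathMetric E d) where

  geodesic : ∀ x y → Walk E x y
  geodesic x y = proj₁ (proj₁ (spm x y))

  length-geodesic : ∀ x y → length (geodesic x y) ≡ d x y
  length-geodesic x y = proj₂ (proj₁ (spm x y))

  dist≤length : ∀ {x y} (p : Walk E x y) → d x y ℕ.≤ length p
  dist≤length {x} {y} = proj₂ (spm x y)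

  dist-refl : ∀ x → d x x ≡ 0
  dist-refl x = ℕₚ.n≤0⇒n≡0 (dist≤length {x} [])

  dist-edge : ∀ {x y} → E x y → d x y ℕ.≤ 1
  dist-edge e = dist≤length (e ∷ [])

  dist-sym : ∀ x y → d x y ≡ d y x
  dist-sym x y = ℕₚ.≤-antisym (sym-≤ x y) (sym-≤ y x)
    where
    sym-≤ : ∀ x y → d x y ℕ.≤ d y x
    sym-≤ x y = subst (d x y ℕ.≤_) (trans (length-reverse graph (geodesic y x)) (length-geodesic y x))
                      (dist≤length (reverse graph (geodesic y x)))

  triangle : ∀ x y z → d y z ℕ.≤ d x y ℕ.+ d x z
  triangle x y z = subst (d y z ℕ.≤_) lengths (dist≤length (geodesic y x ++ʷ geodesic x z))
    where
    lengths : length (geodesic y x ++ʷ geodesic x z) ≡ d x y ℕ.+ d x z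
    lengths = trans (length-++ (geodesic y x) (geodesic x z))
                    (cong₂ ℕ._+_ (trans (length-geodesic y x) (dist-sym y x)) (length-geodesic x z))

  module Rooted (r : V) where

    ρ : V → ℕ
    ρ z = d z r

    ρ-along-walk : ∀ {z v} (p : Walk E z v) → ρ v ℕ.≤ length p ℕ.+ ρ z
    ρ-along-walk {z} {v} p = ℕₚ.≤-trans (triangle z v r) (ℕₚ.+-monoˡ-≤ (ρ z) (dist≤length p))

    gromov≤left : ∀ u v → gromov d r u v ≤ ι (ρ u)
    gromov≤left u v = ⇒gromov≤ (ρ u) (ρ v) (d u v) (ρ u)
      (ℕₚ.≤-trans (ℕₚ.+-monoʳ-≤ (ρ u) (triangle u v r)) (ℕₚ.≤-reflexive (regroup (ρ u) (d u v))))
      where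
      regroup : ∀ a c → a ℕ.+ (c ℕ.+ a) ≡ a ℕ.+ a ℕ.+ c
      regroup = solve-∀

    gromov≤right : ∀ u v → gromov d r u v ≤ ι (ρ v)
    gromov≤right u v = ⇒gromov≤ (ρ u) (ρ v) (d u v) (ρ v)
      (ℕₚ.≤-trans (ℕₚ.+-monoˡ-≤ (ρ v) triangle′) (ℕₚ.≤-reflexive (regroup (ρ v) (d u v))))
      where
      triangle′ : ρ u ℕ.≤ d u v ℕ.+ ρ v
      triangle′ = subst (λ t → ρ u ℕ.≤ t ℕ.+ ρ v) (dist-sym v u) (triangle v u r)
      regroup : ∀ b c → c ℕ.+ b ℕ.+ b ≡ b ℕ.+ b ℕ.+ c
      regroup = solve-∀

    gromov-with-root : ∀ w → gromov d r w r ≡ 0ℚ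
    gromov-with-root w = half-cancel (ι (ρ w)) (d r r) (dist-refl r)

    short-walk-is-good : ∀ m {z v} (p : Walk E z v) → m ℕ.+ m ℕ.+ length p ℕ.≤ ρ z ℕ.+ ρ v →
                         GoodWalk d r m p
    short-walk-is-good m {z} [] h = end (half-≤ (subst (ℕ._≤ ρ z ℕ.+ ρ z) (ℕₚ.+-identityʳ (m ℕ.+ m)) h))
    short-walk-is-good m {z} {v} (_∷_ {w = w} e q) h =
      step (half-≤ start-level) (max-exceeds (ρ z) (ρ w) first-edge) (short-walk-is-good m q rest)
      where
      L = length q
      open ℕₚ.≤-Reasoning
      regroup : ∀ a l b → a ℕ.+ (l ℕ.+ b) ≡ a ℕ.+ b ℕ.+ l
      regroup = solve-∀
      start-level : m ℕ.+ m ℕ.≤ ρ z ℕ.+ ρ z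
      start-level = ℕₚ.+-cancelʳ-≤ (ℕ.suc L) _ _ (begin
        m ℕ.+ m ℕ.+ ℕ.suc L            ≤⟨ h ⟩
        ρ z ℕ.+ ρ v                    ≤⟨ ℕₚ.+-monoʳ-≤ (ρ z) (ρ-along-walk (e ∷ q)) ⟩
        ρ z ℕ.+ (ℕ.suc L ℕ.+ ρ z)      ≡⟨ regroup (ρ z) (ℕ.suc L) (ρ z) ⟩
        ρ z ℕ.+ ρ z ℕ.+ ℕ.suc L        ∎)
      first-edge : ℕ.suc (m ℕ.+ m) ℕ.≤ ρ z ℕ.+ ρ w
      first-edge = ℕₚ.+-cancelʳ-≤ L _ _ (begin
        ℕ.suc (m ℕ.+ m) ℕ.+ L          ≡⟨ sym (ℕₚ.+-suc (m ℕ.+ m) L) ⟩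
        m ℕ.+ m ℕ.+ ℕ.suc L            ≤⟨ h ⟩
        ρ z ℕ.+ ρ v                    ≤⟨ ℕₚ.+-monoʳ-≤ (ρ z) (ρ-along-walk q) ⟩
        ρ z ℕ.+ (L ℕ.+ ρ w)            ≡⟨ regroup (ρ z) L (ρ w) ⟩
        ρ z ℕ.+ ρ w ℕ.+ L              ∎)
      rest : m ℕ.+ m ℕ.+ L ℕ.≤ ρ w ℕ.+ ρ v
      rest = ℕₚ.≤-pred (begin
        ℕ.suc (m ℕ.+ m ℕ.+ L)          ≡⟨ sym (ℕₚ.+-suc (m ℕ.+ m) L) ⟩
        m ℕ.+ m ℕ.+ ℕ.suc L            ≤⟨ h ⟩
        ρ z ℕ.+ ρ v                    ≤⟨ ℕₚ.+-monoˡ-≤ (ρ v) (ρ-along-walk (Graph.sym graph e ∷ [])) ⟩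
        ℕ.suc (ρ w ℕ.+ ρ v)            ∎)

    good-start : ∀ {m x y} {p : Walk E x y} → GoodWalk d r m p → m ℕ.≤ ρ x
    good-start (end m≤ρx)      = m≤ρx
    good-start (step m≤ρx _ _) = m≤ρx

    good-++ : ∀ {m x y z} {p : Walk E x y} {q : Walk E y z} →
              GoodWalk d r m p → GoodWalk d r m q → GoodWalk d r m (p ++ʷ q)
    good-++ (end _)           good-q = good-q
    good-++ (step h₁ h₂ good-p) good-q = step h₁ h₂ (good-++ good-p good-q)

    GoodWalkBetween : ℕ → V → V → Set (a Level.⊔ ℓ)
    GoodWalkBetween m x y = Σ (Walk E x y) (GoodWalk d r m)

    -- A chain whose links all have Gromov product ≥ m yields a good walk:
    -- join consecutive vertices by geodesics.
    chain⇒good-walk : ∀ m x ws y → ι m ≤ chainMin (gromov d r) x ws y → GoodWalkBetween m x y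
    chain⇒good-walk m x [] y h =
      geodesic x y , short-walk-is-good m (geodesic x y)
        (subst (λ t → m ℕ.+ m ℕ.+ t ℕ.≤ ρ x ℕ.+ ρ y) (sym (length-geodesic x y)) (≤gromov⇒ (ρ x) (ρ y) (d x y) m h))
    chain⇒good-walk m x (w ∷ ws) y h =
      join (chain⇒good-walk m x [] w (p≤q⊓r⇒p≤q (gromov d r x w) (chainMin (gromov d r) w ws y) h))
           (chain⇒good-walk m w ws y (p≤q⊓r⇒p≤r (gromov d r x w) (chainMin (gromov d r) w ws y) h))
      where
      join : GoodWalkBetween m x w → GoodWalkBetween m w y → GoodWalkBetween m x y
      join (p , good-p) (q , good-q) = p ++ʷ q , good-++ good-p good-q

    good-walk⇒chain : ∀ m {x y} {p : Walk E x y} → GoodWalk d r m p →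
                      ι m ≤ chainMin (gromov d r) x (interior p) y
    good-walk⇒chain m {x} (end m≤ρx) =
      ⇒≤gromov (ρ x) (ρ x) (d x x) m (subst (λ t → m ℕ.+ m ℕ.+ t ℕ.≤ ρ x ℕ.+ ρ x) (sym (dist-refl x))
                        (subst (ℕ._≤ ρ x ℕ.+ ρ x) (sym (ℕₚ.+-identityʳ (m ℕ.+ m))) (ℕₚ.+-mono-≤ m≤ρx m≤ρx)))
    good-walk⇒chain m {x} (step {w = w} {e = e} m≤ρx m<max good-rest) =
      ⊓-glb (⇒≤gromov (ρ x) (ρ w) (d x w) m (level-edge m≤ρx (good-start good-rest) m<max (dist-edge e)))
            (good-walk⇒chain m good-rest)

    module Approximation {F : V → V → ℚ} (isF : IsF d r F) where

      optimal-chain : ∀ x y → List V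
      optimal-chain x y = proj₁ (proj₁ (isF x y))

      optimal-chain-attains : ∀ x y → chainMin (gromov d r) x (optimal-chain x y) y ≡ F x y
      optimal-chain-attains x y = proj₂ (proj₁ (isF x y))

      F-maximal : ∀ x y ws → chainMin (gromov d r) x ws y ≤ F x y
      F-maximal x y = proj₂ (isF x y)

      -- f(x,y) ≤ min(d(x,r), d(y,r)), via the first and last links
      F≤left : ∀ x y → F x y ≤ ι (ρ x)
      F≤left x y with chainMin-first (gromov d r) x (optimal-chain x y) y
      ... | w , le = subst (_≤ ι (ρ x)) (optimal-chain-attains x y) (≤-trans le (gromov≤left x w))

      F≤right : ∀ x y → F x y ≤ ι (ρ y)
      F≤right x y with chainMin-last (gromov d r) x (optimal-chain x y) y
      ... | w , le = subst (_≤ ι (ρ y)) (optimal-chain-attains x y) (≤-trans le (gromov≤right w y))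

      -- f(x,r) = 0: the last link of any chain ending in r has product 0,
      -- while the one-link chain x, r attains 0.
      F-root : ∀ x → F x r ≡ 0ℚ
      F-root x with chainMin-last (gromov d r) x (optimal-chain x r) r
      ... | w , le = ≤-antisym
        (subst₂ _≤_ (optimal-chain-attains x r) (gromov-with-root w) le)
        (subst (_≤ F x r) (gromov-with-root x) (F-maximal x r []))

      d′-root : ∀ x → d′ d r F x r ≡ ι (ρ x)
      d′-root x = d′-at-root (ι (ρ x)) (d r r) (F x r) (dist-refl r) (F-root x)

      gromov′≡F : ∀ x y → gromov′ d r F x y ≡ F x y
      gromov′≡F x y = trans (cong₂ (λ p q → ½ * (p + q - d′ d r F x y)) (d′-root x) (d′-root y))
                            (recover-product (ι (ρ x)) (ι (ρ y)) (F x y))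

      SameLevelGoodWalk : V → V → Set (a Level.⊔ ℓ)
      SameLevelGoodWalk x y = Σ ℕ λ m → (ρ x ≡ m) × (ρ y ≡ m) × GoodWalkBetween m x y

      -- Part (2), ⇒: d'(x,y) = 0 means 2f(x,y) = d(x,r) + d(y,r); since f is
      -- below both distances they agree with f(x,y) = m, and the optimal chain
      -- has all links ≥ m.
      d′≡0⇒good-walk : ∀ x y → d′ d r F x y ≡ 0ℚ → SameLevelGoodWalk x y
      d′≡0⇒good-walk x y d′≡0 =
        ρ x , refl , ι-injective (trans (sym F≡ρy) F≡ρx) ,
        chain⇒good-walk (ρ x) x (optimal-chain x y) y
          (≤-reflexive (sym (trans (optimal-chain-attains x y) F≡ρx)))
        where
        twice-F : ι (ρ x) + ι (ρ y) ≡ F x y + F x y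
        twice-F = minus-double≡0⇒ (ι (ρ x) + ι (ρ y)) (F x y) d′≡0
        F≡ρx : F x y ≡ ι (ρ x)
        F≡ρx = pinch (F≤left x y) (F≤right x y) twice-F
        F≡ρy : F x y ≡ ι (ρ y)
        F≡ρy = pinch (F≤right x y) (F≤left x y) (trans (+-comm (ι (ρ y)) (ι (ρ x))) twice-F)

      -- Part (2), ⇐: a good walk at level m = d(x,r) = d(y,r) gives f(x,y) ≥ m,
      -- hence f(x,y) = m and d'(x,y) = m + m - 2m = 0.
      good-walk⇒d′≡0 : ∀ x y → SameLevelGoodWalk x y → d′ d r F x y ≡ 0ℚ
      good-walk⇒d′≡0 x y (m , refl , ρy≡ρx , p , good) =
        ⇒minus-double≡0 (ι (ρ x) + ι (ρ y)) (F x y)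
          (cong₂ _+_ (sym F≡ρx) (trans (cong ι ρy≡ρx) (sym F≡ρx)))
        where
        F≡ρx : F x y ≡ ι (ρ x)
        F≡ρx = ≤-antisym (F≤left x y) (≤-trans (good-walk⇒chain m good) (F-maximal x y (interior p)))

mainTheorem3 : ∀ {a ℓ : Level} (V : Set a) (E : V → V → Set ℓ) → Graph V E →
    (d : V → V → ℕ) → IsShortestPathMetric E d →
    (r : V) → (F : V → V → ℚ) → IsF d r F →
    (∀ (x y : V) → gromov′ d r F x y ≡ F x y)
    × (∀ (x y : V) →
        (d′ d r F x y ≡ 0ℚ →
          Σ ℕ λ m → (d x r ≡ m) × (d y r ≡ m) × Σ (Walk E x y) λ p → GoodWalk d r m p)
        × ((Σ ℕ λ m → (d x r ≡ m) × (d y r ≡ m) × Σ (Walk E x y) λ p → GoodWalk d r m p) →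
          d′ d r F x y ≡ 0ℚ))
mainTheorem3 V E graph d spm r F isF =
  gromov′≡F , λ x y → d′≡0⇒good-walk x y , good-walk⇒d′≡0 x y
  where open ShortestPaths.Rooted.Approximation graph spm r isF
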